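{- Let $G$ be a finite group whose order $|G|$ is a product of two distinct primes. Then $\mathcal{P}_e(G)$ is a chordal graph and a cograph.
   Context: For a finite group $G$, the enhanced power graph $\mathcal{P}_e(G)$ is the simple graph with vertex set $G$ in which two distinct vertices $x,y$ are adjacent if and only if $\langle x,y\rangle$ is cyclic. A graph is chordal if it has no induced cycle of length greater than $3$; it is a cograph if it has no induced subgraph isomorphic to the path $P_4$ on four vertices. -}

module Defs where

open import Data.Nat using (ℕ; zero; suc; _+_; _*_; _%_)
open import Data.Nat.Primality using (Prime)
open import Data.Integer using (ℤ; +_; -[1+_])
open import Data.Fin using (Fin; toℕ)
open import Data.Product using (Σ; ∃; _×_)
open import Data.Sum using (_⊎_)
open import Data.Empty using (⊥)
open import Relation.Nullary using (¬_)
open import Relation.Binary.PropositionalEquality using (_≡_; _≢_)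
open import Function.Definitions using (Injective)
open import Algebra.Core using (Op₁; Op₂)
open import Algebra.Structures using (IsGroup)

record FiniteGroup (n : ℕ) : Set where
  field
    _∙_     : Op₂ (Fin n)
    ε       : Fin n
    _⁻¹     : Op₁ (Fin n)
    isGroup : IsGroup _≡_ _∙_ ε _⁻¹

module _ {n : ℕ} (G : FiniteGroup n) where
  open FiniteGroup G

  pow : Fin n → ℕ → Fin n
  pow g zero    = ε
  pow g (suc k) = g ∙ pow g k

  zpow : Fin n → ℤ → Fin n
  zpow g (+ k)     = pow g k
  zpow g -[1+ k ]  = (pow g (suc k)) ⁻¹

  data InGen₂ (x y : Fin n) : Fin n → Set where
    gen-x   : InGen₂ x y x
    gen-y   : InGen₂ x y y
    gen-ε   : InGen₂ x y ε
    gen-∙   : ∀ {a b} → InGen₂ x y a → InGen₂ x y b → InGen₂ x y (a ∙ b)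
    gen-⁻¹  : ∀ {a} → InGen₂ x y a → InGen₂ x y (a ⁻¹)

  Gen₂Cyclic : Fin n → Fin n → Set
  Gen₂Cyclic x y = Σ (Fin n) λ g → InGen₂ x y g ×
                     (∀ h → InGen₂ x y h → ∃ λ (k : ℤ) → h ≡ zpow g k)

  EAdj : Fin n → Fin n → Set
  EAdj x y = x ≢ y × Gen₂Cyclic x y

module _ {n : ℕ} (Adj : Fin n → Fin n → Set) where

  CycNbr : (m : ℕ) → Fin (4 + m) → Fin (4 + m) → Set
  CycNbr m i j = toℕ j ≡ suc (toℕ i) % (4 + m) ⊎ toℕ i ≡ suc (toℕ j) % (4 + m)

  record InducedCycle (m : ℕ) : Set where
    field
      v     : Fin (4 + m) → Fin n
      inj   : Injective _≡_ _≡_ v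
      adj   : ∀ i j → CycNbr m i j → Adj (v i) (v j)
      nonadj : ∀ i j → i ≢ j → ¬ CycNbr m i j → ¬ Adj (v i) (v j)

  Chordal : Set
  Chordal = ∀ m → ¬ InducedCycle m

  record InducedP4 : Set where
    field
      a b c d : Fin n
      a≢b : a ≢ b
      a≢c : a ≢ c
      a≢d : a ≢ d
      b≢c : b ≢ c
      b≢d : b ≢ d
      c≢d : c ≢ d
      ab : Adj a b
      bc : Adj b c
      cd : Adj c d
      ¬ac : ¬ Adj a c
      ¬bd : ¬ Adj b d
      ¬ad : ¬ Adj a d

  Cograph : Set
  Cograph = ¬ InducedP4

-- If ⟨x,y⟩ and ⟨y,z⟩ are cyclic with y ≠ 1, say generated by g and h, then by Lagrange
-- the order of g is 1, prime or pq.  Order 1 is excluded since y ∈ ⟨g⟩; if it is prime,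
-- the nontrivial element y already generates ⟨g⟩; if it is pq, then ⟨g⟩ = G.  The same
-- holds for h, so in every case x and z lie in one cyclic subgroup (⟨y⟩, ⟨g⟩ or ⟨h⟩) and
-- ⟨x,z⟩ is cyclic.  Hence the enhanced power graph is a disjoint union of cliques with the
-- identity joined to every vertex, and such a graph contains neither an induced P₄ nor an
-- induced cycle of length ≥ 4.

module Submission where

open import Defs
open import Level using (0ℓ)
open import Algebra.Bundles using (Group)
open import Algebra.Structures using (IsGroup)
import Algebra.Properties.Group as GroupProperties
open import Data.Nat using (ℕ; zero; suc; _+_; _*_; _<_; _≤_; z≤n; s≤s)
open import Data.Nat.Properties
  using (+-suc; *-suc; +-comm; *-comm; *-identityˡ; m≤n+m; n<1+n; m<n⇒m<1+n; ≤-trans; ≤-pred;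
         m≤n⇒∃[o]m+o≡n)
open import Data.Nat.Divisibility
  using (_∣_; divides; _∣?_; _∣0; 1∣_; ∣-refl; ∣m∣n⇒∣m+n; *-cancelˡ-∣)
open import Data.Nat.Coprimality using (Coprime; coprime-divisor)
open import Data.Nat.GCD using (gcd; gcd-GCD; gcd[m,n]∣m; gcd[m,n]∣n; module Bézout)
open import Data.Nat.Primality using (Prime; prime⇒irreducible; prime⇒nonZero)
open import Data.Fin using (Fin; zero; suc; toℕ; fromℕ<; _≟_)
open import Data.Fin.Patterns using (0F; 1F; 2F; 3F)
open import Data.Fin.Properties
  using (suc-injective; toℕ-fromℕ<; toℕ-inject; toℕ<n; pigeonhole; ¬∀⟶∃¬-smallest)
  renaming (<-cmp to <-cmpᶠ)
open import Data.Fin.Subset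
  using (Subset; inside; outside; ⊤; ⁅_⁆; _∪_; _∩_; ∁; _∈_; _⊆_; _⊂_; ∣_∣; Empty)
  renaming (⊥ to ∅)
open import Data.Fin.Subset.Properties
  using (x∈⁅x⁆; x∈⁅y⁆⇒x≡y; ∣⁅x⁆∣≡1; ∉⊥; ∈⊤; x∈p∪q⁺; x∈p∪q⁻; x∈p∩q⁺; x∈p∩q⁻; p∩q⊆p;
         x∈∁p⇒x∉p; x∉p⇒x∈∁p; drop-∷-Empty; drop-∷-⊆; Empty-unique; nonempty?;
         ∣⊥∣≡0; ∣⊤∣≡n; ∣p∣≡n⇒p≡⊤)
open import Data.Fin.Subset.Induction using (⊂-wellFounded)
open import Data.Vec.Base using ([]; _∷_; here)
open import Data.Integer using (+_; -[1+_])
open import Data.Product using (∃; _×_; _,_; proj₂)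
open import Data.Sum using (_⊎_; inj₁; inj₂)
open import Data.Empty using (⊥; ⊥-elim)
open import Function using (_∘_)
open import Function.Definitions using (Injective)
open import Induction.WellFounded using (Acc; acc)
open import Relation.Binary.Definitions using (tri<; tri≈; tri>)
open import Relation.Binary.PropositionalEquality
open import Relation.Nullary using (¬_; Dec; yes; no)
open import Relation.Nullary.Decidable using (decidable-stable; ¬?)

∣p∪q∣≡∣p∣+∣q∣ : ∀ {n} {p q : Subset n} → Empty (p ∩ q) → ∣ p ∪ q ∣ ≡ ∣ p ∣ + ∣ q ∣
∣p∪q∣≡∣p∣+∣q∣ {p = []}          {[]}          _ = refl
∣p∪q∣≡∣p∣+∣q∣ {p = inside  ∷ p} {inside  ∷ q} e = ⊥-elim (e (zero , here))
∣p∪q∣≡∣p∣+∣q∣ {p = inside  ∷ p} {outside ∷ q} e = cong suc (∣p∪q∣≡∣p∣+∣q∣ (drop-∷-Empty e))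
∣p∪q∣≡∣p∣+∣q∣ {p = outside ∷ p} {inside  ∷ q} e =
  trans (cong suc (∣p∪q∣≡∣p∣+∣q∣ (drop-∷-Empty e))) (sym (+-suc ∣ p ∣ ∣ q ∣))
∣p∪q∣≡∣p∣+∣q∣ {p = outside ∷ p} {outside ∷ q} e = ∣p∪q∣≡∣p∣+∣q∣ (drop-∷-Empty e)

p⊆q⇒∣q∣≡∣p∣+∣q∩∁p∣ : ∀ {n} {p q : Subset n} → p ⊆ q → ∣ q ∣ ≡ ∣ p ∣ + ∣ q ∩ ∁ p ∣
p⊆q⇒∣q∣≡∣p∣+∣q∩∁p∣ {p = []}          {[]}          _ = refl
p⊆q⇒∣q∣≡∣p∣+∣q∩∁p∣ {p = inside  ∷ p} {inside  ∷ q} p⊆q =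
  cong suc (p⊆q⇒∣q∣≡∣p∣+∣q∩∁p∣ (drop-∷-⊆ p⊆q))
p⊆q⇒∣q∣≡∣p∣+∣q∩∁p∣ {p = inside  ∷ p} {outside ∷ q} p⊆q with p⊆q here
... | ()
p⊆q⇒∣q∣≡∣p∣+∣q∩∁p∣ {p = outside ∷ p} {inside  ∷ q} p⊆q =
  trans (cong suc (p⊆q⇒∣q∣≡∣p∣+∣q∩∁p∣ (drop-∷-⊆ p⊆q))) (sym (+-suc ∣ p ∣ _))
p⊆q⇒∣q∣≡∣p∣+∣q∩∁p∣ {p = outside ∷ p} {outside ∷ q} p⊆q =
  p⊆q⇒∣q∣≡∣p∣+∣q∩∁p∣ (drop-∷-⊆ p⊆q)

image : ∀ {m n} → (Fin m → Fin n) → Subset n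
image {zero}  f = ∅
image {suc m} f = ⁅ f zero ⁆ ∪ image (f ∘ suc)

∈-image⁺ : ∀ {m n} (f : Fin m → Fin n) i → f i ∈ image f
∈-image⁺ f zero    = x∈p∪q⁺ (inj₁ (x∈⁅x⁆ (f zero)))
∈-image⁺ f (suc i) = x∈p∪q⁺ (inj₂ (∈-image⁺ (f ∘ suc) i))

∈-image⁻ : ∀ {m n} (f : Fin m → Fin n) {x} → x ∈ image f → ∃ λ i → x ≡ f i
∈-image⁻ {zero}  f x∈ = ⊥-elim (∉⊥ x∈)
∈-image⁻ {suc m} f x∈ with x∈p∪q⁻ ⁅ f zero ⁆ (image (f ∘ suc)) x∈
... | inj₁ x∈⁅f0⁆ = zero , x∈⁅y⁆⇒x≡y (f zero) x∈⁅f0⁆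
... | inj₂ x∈img with ∈-image⁻ (f ∘ suc) x∈img
...   | i , x≡fsi = suc i , x≡fsi

∣image∣≡ : ∀ {m n} (f : Fin m → Fin n) → Injective _≡_ _≡_ f → ∣ image f ∣ ≡ m
∣image∣≡ {zero}  {n} f _ = ∣⊥∣≡0 n
∣image∣≡ {suc m} {n} f f-inj =
  trans (∣p∪q∣≡∣p∣+∣q∣ disjoint)
        (cong₂ _+_ (∣⁅x⁆∣≡1 (f zero)) (∣image∣≡ (f ∘ suc) (λ e → suc-injective (f-inj e))))
  where
  disjoint : Empty (⁅ f zero ⁆ ∩ image (f ∘ suc))
  disjoint (x , x∈) with x∈p∩q⁻ ⁅ f zero ⁆ (image (f ∘ suc)) x∈
  ... | x∈⁅f0⁆ , x∈img with ∈-image⁻ (f ∘ suc) x∈img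
  ... | i , x≡fi with f-inj (trans (sym (x∈⁅y⁆⇒x≡y (f zero) x∈⁅f0⁆)) x≡fi)
  ... | ()

divisor-of-semiprime : ∀ {m p q} → Prime p → Prime q → m ∣ p * q → m ≡ 1 ⊎ Prime m ⊎ m ≡ p * q
divisor-of-semiprime {m} {p} {q} p-prime q-prime m∣pq with p ∣? m
... | yes (divides k refl) with prime⇒irreducible q-prime k∣q
  where
  k∣q : k ∣ q
  k∣q = *-cancelˡ-∣ p {{prime⇒nonZero p-prime}} (subst (_∣ p * q) (*-comm k p) m∣pq)
... | inj₁ refl = inj₂ (inj₁ (subst Prime (sym (*-identityˡ p)) p-prime))
... | inj₂ refl = inj₂ (inj₂ (*-comm q p))
divisor-of-semiprime {m} {p} {q} p-prime q-prime m∣pq | no p∤m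
  with prime⇒irreducible q-prime (coprime-divisor m⊥p m∣pq)
  where
  m⊥p : Coprime m p
  m⊥p {d} (d∣m , d∣p) with prime⇒irreducible p-prime d∣p
  ... | inj₁ d≡1  = d≡1
  ... | inj₂ refl = ⊥-elim (p∤m d∣m)
... | inj₁ m≡1  = inj₁ m≡1
... | inj₂ refl = inj₂ (inj₁ q-prime)

module FiniteGroupProperties {n : ℕ} (G : FiniteGroup n) where

  open FiniteGroup G
  open IsGroup isGroup using (assoc; identityˡ; identityʳ; inverseʳ)

  group : Group 0ℓ 0ℓ
  group = record { isGroup = isGroup }

  open GroupProperties group using (∙-cancelˡ; ∙-cancelʳ; x≈z//y; inverseʳ-unique)

  pow-+ : ∀ g i j → pow G g (i + j) ≡ pow G g i ∙ pow G g j
  pow-+ g zero    j = sym (identityˡ _)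
  pow-+ g (suc i) j = trans (cong (g ∙_) (pow-+ g i j)) (sym (assoc _ _ _))

  pow-* : ∀ g i j → pow G g (j * i) ≡ pow G (pow G g i) j
  pow-* g i zero    = refl
  pow-* g i (suc j) = trans (pow-+ g i (j * i)) (cong (pow G g i ∙_) (pow-* g i j))

  pow-ε : ∀ k → pow G ε k ≡ ε
  pow-ε zero    = refl
  pow-ε (suc k) = trans (identityˡ _) (pow-ε k)

  pow-multiple : ∀ {g r k} → pow G g r ≡ ε → r ∣ k → pow G g k ≡ ε
  pow-multiple {g} {r} gʳ≡ε (divides j refl) =
    trans (pow-* g r j) (trans (cong (λ h → pow G h j) gʳ≡ε) (pow-ε j))

  pow-collision : ∀ g {i j} → i < j → pow G g i ≡ pow G g j →
                  ∃ λ d → d < j × pow G g (suc d) ≡ ε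
  pow-collision g {i} i<j gⁱ≡gʲ with m≤n⇒∃[o]m+o≡n i<j
  ... | d , refl = d , s≤s (m≤n+m d i) , ∙-cancelʳ (pow G g i) _ _ (begin
    pow G g (suc d) ∙ pow G g i  ≡⟨ sym (pow-+ g (suc d) i) ⟩
    pow G g (suc (d + i))        ≡⟨ cong (pow G g ∘ suc) (+-comm d i) ⟩
    pow G g (suc i + d)          ≡⟨ sym gⁱ≡gʲ ⟩
    pow G g i                    ≡⟨ sym (identityˡ _) ⟩
    ε ∙ pow G g i                ∎)
    where open ≡-Reasoning

  -- g has order suc m
  record Order (g : Fin n) : Set where
    field
      m           : ℕ
      pow-suc-m≡ε : pow G g (suc m) ≡ ε
      minimal     : ∀ {d} → d < m → pow G g (suc d) ≢ ε

  order : ∀ g → Order g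
  order g with ¬∀⟶∃¬-smallest n Nontrivial (λ _ → ¬? (_ ≟ ε)) some-pow≡ε
    where
    Nontrivial : Fin n → Set
    Nontrivial i = pow G g (suc (toℕ i)) ≢ ε

    some-pow≡ε : ¬ (∀ i → Nontrivial i)
    some-pow≡ε all-nontrivial
      with pigeonhole (n<1+n n) (λ (i : Fin (suc n)) → pow G g (toℕ i))
    ... | i , j , i<j , gⁱ≡gʲ with pow-collision g i<j gⁱ≡gʲ
    ... | d , d<j , gᵈ⁺¹≡ε = all-nontrivial (fromℕ< d<n)
                               (subst (λ k → pow G g (suc k) ≡ ε) (sym (toℕ-fromℕ< d<n)) gᵈ⁺¹≡ε)
      where
      d<n : d < n
      d<n = ≤-trans d<j (≤-pred (toℕ<n j))
  ... | i , ¬¬gⁱ⁺¹≡ε , below = record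
    { m           = toℕ i
    ; pow-suc-m≡ε = decidable-stable (_ ≟ ε) ¬¬gⁱ⁺¹≡ε
    ; minimal     = λ d<i gᵈ⁺¹≡ε → below (fromℕ< d<i)
                      (subst (λ k → pow G g (suc k) ≡ ε)
                             (sym (trans (toℕ-inject (fromℕ< d<i)) (toℕ-fromℕ< d<i))) gᵈ⁺¹≡ε)
    }

  pow-distinct : ∀ {g} (o : Order g) {i j} → i < j → j ≤ Order.m o → pow G g i ≢ pow G g j
  pow-distinct {g} o i<j j≤m gⁱ≡gʲ with pow-collision g i<j gⁱ≡gʲ
  ... | d , d<j , gᵈ⁺¹≡ε = Order.minimal o (≤-trans d<j j≤m) gᵈ⁺¹≡ε

  pow-injective : ∀ {g} (o : Order g) →
                  Injective _≡_ _≡_ (λ (i : Fin (suc (Order.m o))) → pow G g (toℕ i))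
  pow-injective o {i} {j} gⁱ≡gʲ with <-cmpᶠ i j
  ... | tri≈ _ i≡j _ = i≡j
  ... | tri< i<j _ _ = ⊥-elim (pow-distinct o i<j (≤-pred (toℕ<n j)) gⁱ≡gʲ)
  ... | tri> _ _ j<i = ⊥-elim (pow-distinct o j<i (≤-pred (toℕ<n i)) (sym gⁱ≡gʲ))

  _∈⟨_⟩ : Fin n → Fin n → Set
  h ∈⟨ g ⟩ = ∃ λ k → h ≡ pow G g k

  LeftInvariant : Fin n → Subset n → Set
  LeftInvariant g T = ∀ {t} → t ∈ T → g ∙ t ∈ T

  module _ {g : Fin n} (o : Order g) where

    open Order o

    orbit-map : Fin n → Fin (suc m) → Fin n
    orbit-map s i = pow G g (toℕ i) ∙ s

    orbit : Fin n → Subset n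
    orbit s = image (orbit-map s)

    ∣orbit∣≡ : ∀ s → ∣ orbit s ∣ ≡ suc m
    ∣orbit∣≡ s = ∣image∣≡ (orbit-map s) (λ e → pow-injective o (∙-cancelʳ s _ _ e))

    ∈orbit⁺ : ∀ {k} s → k < suc m → pow G g k ∙ s ∈ orbit s
    ∈orbit⁺ s k<ord = subst (λ k → pow G g k ∙ s ∈ orbit s) (toℕ-fromℕ< k<ord)
                            (∈-image⁺ (orbit-map s) (fromℕ< k<ord))

    ∈orbit⁻ : ∀ {s x} → x ∈ orbit s → ∃ λ k → k < suc m × x ≡ pow G g k ∙ s
    ∈orbit⁻ {s} x∈orbit with ∈-image⁻ (orbit-map s) x∈orbit
    ... | i , x≡gⁱs = toℕ i , toℕ<n i , x≡gⁱs

    s∈orbit : ∀ s → s ∈ orbit s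
    s∈orbit s = subst (_∈ orbit s) (identityˡ s) (∈orbit⁺ s (s≤s z≤n))

    orbit⊆ : ∀ {T s} → LeftInvariant g T → s ∈ T → orbit s ⊆ T
    orbit⊆ {T} {s} T-invariant s∈T x∈orbit with ∈orbit⁻ x∈orbit
    ... | k , _ , refl = pow∙∈ k
      where
      pow∙∈ : ∀ k → pow G g k ∙ s ∈ T
      pow∙∈ zero    = subst (_∈ T) (sym (identityˡ s)) s∈T
      pow∙∈ (suc k) = subst (_∈ T) (sym (assoc g _ s)) (T-invariant (pow∙∈ k))

    ∙∈orbit⇒∈orbit : ∀ {s t} → g ∙ t ∈ orbit s → t ∈ orbit s
    ∙∈orbit⇒∈orbit {s} {t} gt∈orbit with ∈orbit⁻ gt∈orbit
    ... | zero , _ , gt≡s = subst (_∈ orbit s) (sym (∙-cancelˡ g _ _ (begin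
      g ∙ t                ≡⟨ gt≡s ⟩
      ε ∙ s                ≡⟨ cong (_∙ s) (sym pow-suc-m≡ε) ⟩
      pow G g (suc m) ∙ s  ≡⟨ assoc g _ s ⟩
      g ∙ (pow G g m ∙ s)  ∎))) (∈orbit⁺ s (n<1+n m))
      where open ≡-Reasoning
    ... | suc k , k<m , gt≡gᵏ⁺¹s =
      subst (_∈ orbit s) (sym (∙-cancelˡ g _ _ (trans gt≡gᵏ⁺¹s (assoc g _ s))))
            (∈orbit⁺ s (m<n⇒m<1+n (≤-pred k<m)))

    -- A g-invariant subset is a disjoint union of orbits, each of size suc m.
    order∣∣invariant∣ : ∀ T → LeftInvariant g T → suc m ∣ ∣ T ∣
    order∣∣invariant∣ T = go T (⊂-wellFounded T)
      where
      go : ∀ T → Acc _⊂_ T → LeftInvariant g T → suc m ∣ ∣ T ∣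
      go T (acc smaller) T-invariant with nonempty? T
      ... | no T-empty = subst (suc m ∣_) (sym (trans (cong ∣_∣ (Empty-unique T-empty)) (∣⊥∣≡0 n)))
                               (suc m ∣0)
      ... | yes (s , s∈T) = subst (suc m ∣_) (sym ∣T∣≡)
                                  (∣m∣n⇒∣m+n ∣-refl (go R (smaller R⊂T) R-invariant))
        where
        R : Subset n
        R = T ∩ ∁ (orbit s)

        ∣T∣≡ : ∣ T ∣ ≡ suc m + ∣ R ∣
        ∣T∣≡ = trans (p⊆q⇒∣q∣≡∣p∣+∣q∩∁p∣ (orbit⊆ T-invariant s∈T)) (cong (_+ ∣ R ∣) (∣orbit∣≡ s))

        R⊂T : R ⊂ T
        R⊂T = p∩q⊆p T _ , s , s∈T , λ s∈R → x∈∁p⇒x∉p (proj₂ (x∈p∩q⁻ T _ s∈R)) (s∈orbit s)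

        R-invariant : LeftInvariant g R
        R-invariant t∈R with x∈p∩q⁻ T _ t∈R
        ... | t∈T , t∈∁orbit =
          x∈p∩q⁺ (T-invariant t∈T , x∉p⇒x∈∁p (x∈∁p⇒x∉p t∈∁orbit ∘ ∙∈orbit⇒∈orbit))

    order∣n : suc m ∣ n
    order∣n = subst (suc m ∣_) (∣⊤∣≡n n) (order∣∣invariant∣ ⊤ (λ _ → ∈⊤))

    order≡n⇒generates : suc m ≡ n → ∀ t → t ∈⟨ g ⟩
    order≡n⇒generates ord≡n t with ∈orbit⁻ t∈orbit
      where
      t∈orbit : t ∈ orbit ε
      t∈orbit = subst (t ∈_) (sym (∣p∣≡n⇒p≡⊤ (trans (∣orbit∣≡ ε) ord≡n))) ∈⊤
    ... | k , _ , t≡gᵏ = k , trans t≡gᵏ (identityʳ _)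

  record IsSubgroup (S : Fin n → Set) : Set where
    field
      ε-closed  : S ε
      ∙-closed  : ∀ {a b} → S a → S b → S (a ∙ b)
      ⁻¹-closed : ∀ {a} → S a → S (a ⁻¹)

    pow-closed : ∀ {a} k → S a → S (pow G a k)
    pow-closed zero    _   = ε-closed
    pow-closed (suc k) a∈S = ∙-closed a∈S (pow-closed k a∈S)

    pow-*-closed : ∀ c {a} k → S (pow G c a) → S (pow G c (k * a))
    pow-*-closed c {a} k cᵃ∈S = subst S (sym (pow-* c a k)) (pow-closed k cᵃ∈S)

    pow-+-cancel-closed : ∀ c {d e f} → d + e ≡ f → S (pow G c e) → S (pow G c f) → S (pow G c d)
    pow-+-cancel-closed c {d} {e} d+e≡f cᵉ∈S cᶠ∈S =
      subst S (sym (x≈z//y _ _ _ (trans (sym (pow-+ c d e)) (cong (pow G c) d+e≡f))))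
            (∙-closed cᶠ∈S (⁻¹-closed cᵉ∈S))

    pow-gcd-closed : ∀ c a b → S (pow G c a) → S (pow G c b) → S (pow G c (gcd a b))
    pow-gcd-closed c a b cᵃ∈S cᵇ∈S with Bézout.identity (gcd-GCD a b)
    ... | Bézout.+- x y eq =
      pow-+-cancel-closed c {gcd a b} eq (pow-*-closed c y cᵇ∈S) (pow-*-closed c x cᵃ∈S)
    ... | Bézout.-+ x y eq =
      pow-+-cancel-closed c {gcd a b} eq (pow-*-closed c x cᵃ∈S) (pow-*-closed c y cᵇ∈S)

  InGen₂-isSubgroup : ∀ x y → IsSubgroup (InGen₂ G x y)
  InGen₂-isSubgroup x y = record { ε-closed = gen-ε ; ∙-closed = gen-∙ ; ⁻¹-closed = gen-⁻¹ }

  InGen₂-least : ∀ {S x y h} → IsSubgroup S → S x → S y → InGen₂ G x y h → S h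
  InGen₂-least S-sub x∈S y∈S gen-x         = x∈S
  InGen₂-least S-sub x∈S y∈S gen-y         = y∈S
  InGen₂-least S-sub x∈S y∈S gen-ε         = IsSubgroup.ε-closed S-sub
  InGen₂-least S-sub x∈S y∈S (gen-∙ a∈ b∈) =
    IsSubgroup.∙-closed S-sub (InGen₂-least S-sub x∈S y∈S a∈) (InGen₂-least S-sub x∈S y∈S b∈)
  InGen₂-least S-sub x∈S y∈S (gen-⁻¹ a∈)   =
    IsSubgroup.⁻¹-closed S-sub (InGen₂-least S-sub x∈S y∈S a∈)

  pow⁻¹∈⟨⟩ : ∀ g k → pow G g k ⁻¹ ∈⟨ g ⟩
  pow⁻¹∈⟨⟩ g k = k * m , sym (inverseʳ-unique _ _ (begin
    pow G g k ∙ pow G g (k * m)  ≡⟨ sym (pow-+ g k (k * m)) ⟩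
    pow G g (k + k * m)          ≡⟨ cong (pow G g) (sym (*-suc k m)) ⟩
    pow G g (k * suc m)          ≡⟨ pow-multiple pow-suc-m≡ε (divides k refl) ⟩
    ε                            ∎))
    where
    open Order (order g)
    open ≡-Reasoning

  ⟨⟩-isSubgroup : ∀ g → IsSubgroup (_∈⟨ g ⟩)
  ⟨⟩-isSubgroup g = record
    { ε-closed  = 0 , refl
    ; ∙-closed  = λ { (i , refl) (j , refl) → i + j , sym (pow-+ g i j) }
    ; ⁻¹-closed = λ { (i , refl) → pow⁻¹∈⟨⟩ g i }
    }

  ∈⟨⟩-trans : ∀ {x y g} → x ∈⟨ y ⟩ → y ∈⟨ g ⟩ → x ∈⟨ g ⟩
  ∈⟨⟩-trans {g = g} (i , refl) y∈⟨g⟩ = IsSubgroup.pow-closed (⟨⟩-isSubgroup g) i y∈⟨g⟩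

  zpow∈⟨⟩ : ∀ g k → zpow G g k ∈⟨ g ⟩
  zpow∈⟨⟩ g (+ k)     = k , refl
  zpow∈⟨⟩ g -[1+ k ]  = pow⁻¹∈⟨⟩ g (suc k)

  Cocyclic : Fin n → Fin n → Set
  Cocyclic x y = ∃ λ g → x ∈⟨ g ⟩ × y ∈⟨ g ⟩

  Gen₂Cyclic⇒Cocyclic : ∀ {x y} → Gen₂Cyclic G x y → Cocyclic x y
  Gen₂Cyclic⇒Cocyclic {x} {y} (g , _ , zpowers) = g , in⟨g⟩ gen-x , in⟨g⟩ gen-y
    where
    in⟨g⟩ : ∀ {h} → InGen₂ G x y h → h ∈⟨ g ⟩
    in⟨g⟩ h∈ with zpowers _ h∈
    ... | k , refl = zpow∈⟨⟩ g k

  Cocyclic⇒Gen₂Cyclic : ∀ {x y} → Cocyclic x y → Gen₂Cyclic G x y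
  Cocyclic⇒Gen₂Cyclic (c , (a , refl) , (b , refl)) =
    d , IsSubgroup.pow-gcd-closed (InGen₂-isSubgroup _ _) c a b gen-x gen-y , zpowers
    where
    d : Fin n
    d = pow G c (gcd a b)

    multiple∈⟨d⟩ : ∀ {e} → gcd a b ∣ e → pow G c e ∈⟨ d ⟩
    multiple∈⟨d⟩ (divides k refl) = k , pow-* c (gcd a b) k

    zpowers : ∀ h → InGen₂ G (pow G c a) (pow G c b) h → ∃ λ k → h ≡ zpow G d k
    zpowers h h∈ with InGen₂-least (⟨⟩-isSubgroup d)
                        (multiple∈⟨d⟩ (gcd[m,n]∣m a b)) (multiple∈⟨d⟩ (gcd[m,n]∣n a b)) h∈
    ... | k , h≡dᵏ = + k , h≡dᵏ

  prime-order⇒∈⟨pow⟩ : ∀ {g r j} → Prime r → pow G g r ≡ ε → pow G g j ≢ ε → g ∈⟨ pow G g j ⟩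
  prime-order⇒∈⟨pow⟩ {g} {r} {j} r-prime gʳ≡ε gʲ≢ε
    with prime⇒irreducible r-prime (gcd[m,n]∣n j r)
  ... | inj₂ gcd≡r = ⊥-elim (gʲ≢ε (pow-multiple gʳ≡ε (subst (_∣ j) gcd≡r (gcd[m,n]∣m j r))))
  ... | inj₁ gcd≡1 = subst (_∈⟨ pow G g j ⟩) (identityʳ g)
    (subst (λ k → pow G g k ∈⟨ pow G g j ⟩) gcd≡1
      (IsSubgroup.pow-gcd-closed (⟨⟩-isSubgroup (pow G g j)) g j r
        (1 , sym (identityʳ _)) (0 , gʳ≡ε)))

  ε-EAdj : ∀ {v} → ε ≢ v → EAdj G ε v
  ε-EAdj {v} ε≢v = ε≢v , Cocyclic⇒Gen₂Cyclic (v , (0 , refl) , (1 , sym (identityʳ v)))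

module _ {n p q : ℕ} (G : FiniteGroup n) (p-prime : Prime p) (q-prime : Prime q) (n≡pq : n ≡ p * q)
  where

  open FiniteGroup G
  open FiniteGroupProperties G

  nontrivial-power-dichotomy : ∀ {g y} → y ∈⟨ g ⟩ → y ≢ ε → g ∈⟨ y ⟩ ⊎ (∀ t → t ∈⟨ g ⟩)
  nontrivial-power-dichotomy {g} (j , refl) gʲ≢ε =
    by-order (divisor-of-semiprime p-prime q-prime (subst (suc m ∣_) n≡pq (order∣n o)))
    where
    o : Order g
    o = order g
    open Order o

    by-order : suc m ≡ 1 ⊎ Prime (suc m) ⊎ suc m ≡ p * q → g ∈⟨ pow G g j ⟩ ⊎ (∀ t → t ∈⟨ g ⟩)
    by-order (inj₁ ord≡1)            =
      ⊥-elim (gʲ≢ε (pow-multiple (subst (λ k → pow G g k ≡ ε) ord≡1 pow-suc-m≡ε) (1∣ j)))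
    by-order (inj₂ (inj₁ ord-prime)) = inj₁ (prime-order⇒∈⟨pow⟩ {j = j} ord-prime pow-suc-m≡ε gʲ≢ε)
    by-order (inj₂ (inj₂ ord≡pq))    = inj₂ (order≡n⇒generates o (trans ord≡pq (sym n≡pq)))

  Cocyclic-trans : ∀ {x y z} → y ≢ ε → Cocyclic x y → Cocyclic y z → Cocyclic x z
  Cocyclic-trans y≢ε (g , x∈⟨g⟩ , y∈⟨g⟩) (h , y∈⟨h⟩ , z∈⟨h⟩)
    with nontrivial-power-dichotomy y∈⟨g⟩ y≢ε | nontrivial-power-dichotomy y∈⟨h⟩ y≢ε
  ... | inj₂ ⟨g⟩≡G | _              = g , ⟨g⟩≡G _ , ⟨g⟩≡G _
  ... | inj₁ _     | inj₂ ⟨h⟩≡G     = h , ⟨h⟩≡G _ , ⟨h⟩≡G _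
  ... | inj₁ g∈⟨y⟩ | inj₁ h∈⟨y⟩     = _ , ∈⟨⟩-trans x∈⟨g⟩ g∈⟨y⟩ , ∈⟨⟩-trans z∈⟨h⟩ h∈⟨y⟩

  EAdj-trans : ∀ {a b c} → b ≢ ε → a ≢ c → EAdj G a b → EAdj G b c → EAdj G a c
  EAdj-trans b≢ε a≢c (_ , ab) (_ , bc) =
    a≢c , Cocyclic⇒Gen₂Cyclic (Cocyclic-trans b≢ε (Gen₂Cyclic⇒Cocyclic ab) (Gen₂Cyclic⇒Cocyclic bc))

-- Removing the apex leaves a disjoint union of cliques.
module ConeOverCliques {n : ℕ} {Adj : Fin n → Fin n → Set} (apex : Fin n)
  (apex-adj : ∀ {v} → apex ≢ v → Adj apex v)
  (adj-trans : ∀ {a b c} → b ≢ apex → a ≢ c → Adj a b → Adj b c → Adj a c)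
  where

  adj-from-apex : ∀ {u v} → u ≡ apex → u ≢ v → Adj u v
  adj-from-apex refl = apex-adj

  cograph : Cograph Adj
  cograph P = by-apex (b ≟ apex)
    where
    open InducedP4 P

    by-apex : Dec (b ≡ apex) → ⊥
    by-apex (yes b≡apex) = ¬bd (adj-from-apex b≡apex b≢d)
    by-apex (no  b≢apex) = ¬ac (adj-trans b≢apex a≢c ab bc)

  chordal : Chordal Adj
  chordal m C = by-apex (v 1F ≟ apex)
    where
    open InducedCycle C

    1≢3 : 1F ≢ 3F
    1≢3 ()

    0≢2 : 0F ≢ 2F
    0≢2 ()

    ¬nbr₁₃ : ∀ m → ¬ CycNbr Adj m 1F 3F
    ¬nbr₁₃ zero    (inj₁ ())
    ¬nbr₁₃ zero    (inj₂ ())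
    ¬nbr₁₃ (suc m) (inj₁ ())
    ¬nbr₁₃ (suc m) (inj₂ ())

    ¬nbr₀₂ : ¬ CycNbr Adj m 0F 2F
    ¬nbr₀₂ (inj₁ ())
    ¬nbr₀₂ (inj₂ ())

    by-apex : Dec (v 1F ≡ apex) → ⊥
    by-apex (yes v₁≡apex) =
      nonadj 1F 3F 1≢3 (¬nbr₁₃ m) (adj-from-apex v₁≡apex (1≢3 ∘ inj))
    by-apex (no v₁≢apex) =
      nonadj 0F 2F 0≢2 ¬nbr₀₂
        (adj-trans v₁≢apex (0≢2 ∘ inj) (adj 0F 1F (inj₁ refl)) (adj 1F 2F (inj₁ refl)))

proposition4p16 : (n p q : ℕ) → Prime p → Prime q → p ≢ q → n ≡ p * q →
                  (G : FiniteGroup n) →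
                  Chordal (EAdj G) × Cograph (EAdj G)
proposition4p16 n p q p-prime q-prime _ n≡pq G = chordal , cograph
  where
  open ConeOverCliques (FiniteGroup.ε G) (FiniteGroupProperties.ε-EAdj G)
                       (EAdj-trans G p-prime q-prime n≡pq)
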